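{- Let $W\subseteq[0,1]\cap\mathbb Q$ be finite with $0\in W$ and $k=|W|\geq 2$. Let $\mathbf a\in\mathbb Z^n$ be nonzero and let $b\in\mathbb Q$. The number of $\mathbf s\in W^n$ such that $\mathbf a\mathbf s=b$ is at most $\frac{k^n}{\sqrt{w(\mathbf a)}}$, where $w(\mathbf a)$ is the number of nonzero coordinates of $\mathbf a$. -}

module Defs where

open import Data.Nat using (ℕ; zero; suc)
open import Data.Integer using (ℤ; +_)
open import Data.Rational using (ℚ; 0ℚ; _+_; _*_; _/_)
open import Data.Rational.Properties using (_≟_)
open import Data.List using (List; []; _∷_; concatMap; map; length; filter)
open import Data.Vec using (Vec; []; _∷_; toList)
import Data.Integer.Properties as ℤP
open import Relation.Nullary.Decidable using (¬?)

ℤtoℚ : ℤ → ℚ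
ℤtoℚ z = z / 1

powVec : {A : Set} → List A → (n : ℕ) → List (Vec A n)
powVec W zero = [] ∷ []
powVec W (suc n) = concatMap (λ x → map (x ∷_) (powVec W n)) W

dot : {n : ℕ} → Vec ℤ n → Vec ℚ n → ℚ
dot [] [] = 0ℚ
dot (a ∷ as) (s ∷ ss) = ℤtoℚ a * s + dot as ss

weight : {n : ℕ} → Vec ℤ n → ℕ
weight a = length (filter (λ x → ¬? (x ℤP.≟ + 0)) (toList a))

countSol : {n : ℕ} → List ℚ → Vec ℤ n → ℚ → ℕ
countSol {n} W a b = length (filter (λ s → dot a s ≟ b) (powVec W n))

-- Choose for every coordinate an unordered pair {xᵢ, yᵢ} of distinct elements of W. Each
-- s ∈ Wⁿ lies in exactly (k − 1)ⁿ of the (k(k − 1)/2)ⁿ boxes ∏ᵢ {xᵢ, yᵢ}, so averaging over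
-- the boxes it suffices to bound the number of solutions of a · s = b inside one box by
-- 2ᶻ · C(w, ⌊w/2⌋), where z = n − w counts the zero coefficients. Inside a box the equation
-- is a subset-sum equation with the steps aᵢ(yᵢ − xᵢ), exactly w of which are nonzero; after
-- flipping signs they are positive, so by the Littlewood–Offord–Erdős argument each of the
-- C(w, ⌊w/2⌋) chains of a symmetric chain decomposition of the Boolean lattice contains at
-- most one solution. Finally C(w, ⌊w/2⌋)² · w ≤ 4ʷ.

module Submission where

module MiddleBinomial where

  open import Data.Nat
  open import Data.Nat.Properties
  open import Data.Nat.Combinatorics using (_C_; nC1≡n; nCk≡nC[n∸k]; nCk+nC[k+1]≡[n+1]C[k+1])
  open import Data.Nat.Tactic.RingSolver using (solve-∀)
  open import Relation.Binary.PropositionalEquality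

  [1+k]*[1+n]C[1+k]≡[1+n]*nCk : ∀ n k → suc k * (suc n C suc k) ≡ suc n * (n C k)
  [1+k]*[1+n]C[1+k]≡[1+n]*nCk zero zero = refl
  [1+k]*[1+n]C[1+k]≡[1+n]*nCk zero (suc k) = *-zeroʳ (2 + k)
  [1+k]*[1+n]C[1+k]≡[1+n]*nCk (suc n) zero = trans (*-identityˡ _) (trans (nC1≡n (2 + n)) (sym (*-identityʳ (2 + n))))
  [1+k]*[1+n]C[1+k]≡[1+n]*nCk (suc n) (suc k) = begin
    (2 + k) * ((2 + n) C (2 + k))                          ≡⟨ cong ((2 + k) *_) (sym (nCk+nC[k+1]≡[n+1]C[k+1] (suc n) (suc k))) ⟩
    (2 + k) * (suc n C suc k + suc n C (2 + k))           ≡⟨ regroup (suc n C suc k) (suc n C (2 + k)) k ⟩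
    suc n C suc k + suc k * (suc n C suc k) + (2 + k) * (suc n C (2 + k))
      ≡⟨ cong₂ (λ x y → suc n C suc k + x + y) ([1+k]*[1+n]C[1+k]≡[1+n]*nCk n k) ([1+k]*[1+n]C[1+k]≡[1+n]*nCk n (suc k)) ⟩
    suc n C suc k + suc n * (n C k) + suc n * (n C suc k) ≡⟨ collect (suc n C suc k) (n C k) (n C suc k) n ⟩
    suc n C suc k + suc n * (n C k + n C suc k)          ≡⟨ cong (λ x → suc n C suc k + suc n * x) (nCk+nC[k+1]≡[n+1]C[k+1] n k) ⟩
    (2 + n) * (suc n C suc k)                            ∎
    where
    open ≡-Reasoning
    regroup : ∀ x y k → (2 + k) * (x + y) ≡ x + suc k * x + (2 + k) * y
    regroup = solve-∀
    collect : ∀ x y z n → x + suc n * y + suc n * z ≡ x + suc n * (y + z)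
    collect = solve-∀

  centralBinomial : ℕ → ℕ
  centralBinomial n = (n + n) C n

  [1+2n]C[1+n]≡[1+2n]Cn : ∀ n → suc (n + n) C suc n ≡ suc (n + n) C n
  [1+2n]C[1+n]≡[1+2n]Cn n =
    trans (nCk≡nC[n∸k] (s≤s (m≤n+m n n))) (cong (suc (n + n) C_) (m+n∸n≡m n n))

  centralBinomial-suc : ∀ n → centralBinomial (suc n) ≡ suc (n + n) C n + suc (n + n) C n
  centralBinomial-suc n = begin
    (suc n + suc n) C suc n                   ≡⟨ cong (λ m → suc m C suc n) (+-suc n n) ⟩
    suc (suc (n + n)) C suc n                 ≡⟨ sym (nCk+nC[k+1]≡[n+1]C[k+1] (suc (n + n)) n) ⟩
    suc (n + n) C n + suc (n + n) C suc n     ≡⟨ cong (suc (n + n) C n +_) ([1+2n]C[1+n]≡[1+2n]Cn n) ⟩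
    suc (n + n) C n + suc (n + n) C n         ∎
    where open ≡-Reasoning

  [1+n]*[1+2n]Cn≡[1+2n]*centralBinomial : ∀ n → suc n * (suc (n + n) C n) ≡ suc (n + n) * centralBinomial n
  [1+n]*[1+2n]Cn≡[1+2n]*centralBinomial n =
    trans (cong (suc n *_) (sym ([1+2n]C[1+n]≡[1+2n]Cn n))) ([1+k]*[1+n]C[1+k]≡[1+n]*nCk (n + n) n)

  -- The factor 3n + 1, rather than the 2n of the final bound, is what makes the induction close.
  centralBinomial-bound : ∀ n → centralBinomial n * centralBinomial n * suc (3 * n) ≤ 16 ^ n
  centralBinomial-bound zero = ≤-refl
  centralBinomial-bound (suc n) = *-cancelˡ-≤ (suc n * suc n * suc (3 * n)) (begin
    suc n * suc n * suc (3 * n) * (c′ * c′ * suc (3 * suc n))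
      ≡⟨ cong (λ x → suc n * suc n * suc (3 * n) * (x * x * suc (3 * suc n))) (centralBinomial-suc n) ⟩
    suc n * suc n * suc (3 * n) * ((o + o) * (o + o) * suc (3 * suc n))
      ≡⟨ factor-odd n o ⟩
    4 * (suc n * o) * (suc n * o) * suc (3 * suc n) * suc (3 * n)
      ≡⟨ cong (λ x → 4 * x * x * suc (3 * suc n) * suc (3 * n)) ([1+n]*[1+2n]Cn≡[1+2n]*centralBinomial n) ⟩
    4 * (suc (n + n) * c) * (suc (n + n) * c) * suc (3 * suc n) * suc (3 * n)
      ≡⟨ factor-central n c ⟩
    4 * suc (n + n) * suc (n + n) * suc (3 * suc n) * (c * c * suc (3 * n))
      ≤⟨ *-monoʳ-≤ (4 * suc (n + n) * suc (n + n) * suc (3 * suc n)) (centralBinomial-bound n) ⟩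
    4 * suc (n + n) * suc (n + n) * suc (3 * suc n) * 16 ^ n
      ≤⟨ *-monoˡ-≤ (16 ^ n) (m+n≤o⇒m≤o (4 * suc (n + n) * suc (n + n) * suc (3 * suc n)) (≤-reflexive (growth n))) ⟩
    16 * suc n * suc n * suc (3 * n) * 16 ^ n
      ≡⟨ reassociate n (16 ^ n) ⟩
    suc n * suc n * suc (3 * n) * 16 ^ suc n ∎)
    where
    open ≤-Reasoning
    c : ℕ
    c = centralBinomial n
    o : ℕ
    o = suc (n + n) C n
    c′ : ℕ
    c′ = centralBinomial (suc n)
    factor-odd : ∀ n o → suc n * suc n * suc (3 * n) * ((o + o) * (o + o) * suc (3 * suc n))
                       ≡ 4 * (suc n * o) * (suc n * o) * suc (3 * suc n) * suc (3 * n)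
    factor-odd = solve-∀
    factor-central : ∀ n c → 4 * (suc (n + n) * c) * (suc (n + n) * c) * suc (3 * suc n) * suc (3 * n)
                           ≡ 4 * suc (n + n) * suc (n + n) * suc (3 * suc n) * (c * c * suc (3 * n))
    factor-central = solve-∀
    growth : ∀ n → 4 * suc (n + n) * suc (n + n) * suc (3 * suc n) + 4 * n ≡ 16 * suc n * suc n * suc (3 * n)
    growth = solve-∀
    reassociate : ∀ n x → 16 * suc n * suc n * suc (3 * n) * x ≡ suc n * suc n * suc (3 * n) * (16 * x)
    reassociate = solve-∀

  [1+2n]Cn-bound : ∀ n → (suc (n + n) C n) * (suc (n + n) C n) * suc (n + n) ≤ 4 * 16 ^ n
  [1+2n]Cn-bound n = *-cancelˡ-≤ (suc n * suc n * suc (3 * n)) (begin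
    suc n * suc n * suc (3 * n) * (o * o * suc (n + n))
      ≡⟨ factor-odd n o ⟩
    suc (3 * n) * suc (n + n) * ((suc n * o) * (suc n * o))
      ≡⟨ cong (λ x → suc (3 * n) * suc (n + n) * (x * x)) ([1+n]*[1+2n]Cn≡[1+2n]*centralBinomial n) ⟩
    suc (3 * n) * suc (n + n) * ((suc (n + n) * c) * (suc (n + n) * c))
      ≡⟨ factor-central n c ⟩
    suc (n + n) * suc (n + n) * suc (n + n) * (c * c * suc (3 * n))
      ≤⟨ *-monoʳ-≤ (suc (n + n) * suc (n + n) * suc (n + n)) (centralBinomial-bound n) ⟩
    suc (n + n) * suc (n + n) * suc (n + n) * 16 ^ n
      ≤⟨ *-monoˡ-≤ (16 ^ n) (m+n≤o⇒m≤o (suc (n + n) * suc (n + n) * suc (n + n)) (≤-reflexive (growth n))) ⟩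
    4 * suc n * suc n * suc (3 * n) * 16 ^ n
      ≡⟨ reassociate n (16 ^ n) ⟩
    suc n * suc n * suc (3 * n) * (4 * 16 ^ n) ∎)
    where
    open ≤-Reasoning
    c : ℕ
    c = centralBinomial n
    o : ℕ
    o = suc (n + n) C n
    factor-odd : ∀ n o → suc n * suc n * suc (3 * n) * (o * o * suc (n + n))
                       ≡ suc (3 * n) * suc (n + n) * ((suc n * o) * (suc n * o))
    factor-odd = solve-∀
    factor-central : ∀ n c → suc (3 * n) * suc (n + n) * ((suc (n + n) * c) * (suc (n + n) * c))
                           ≡ suc (n + n) * suc (n + n) * suc (n + n) * (c * c * suc (3 * n))
    factor-central = solve-∀
    growth : ∀ n → suc (n + n) * suc (n + n) * suc (n + n) + (4 * n * n * n + 16 * n * n + 14 * n + 3)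
                 ≡ 4 * suc n * suc n * suc (3 * n)
    growth = solve-∀
    reassociate : ∀ n x → 4 * suc n * suc n * suc (3 * n) * x ≡ suc n * suc n * suc (3 * n) * (4 * x)
    reassociate = solve-∀

  data EvenOdd : ℕ → Set where
    even : ∀ n → EvenOdd (n + n)
    odd  : ∀ n → EvenOdd (suc (n + n))

  evenOdd : ∀ w → EvenOdd w
  evenOdd zero = even zero
  evenOdd (suc w) with evenOdd w
  ... | even n = odd n
  ... | odd n = subst EvenOdd (cong suc (+-suc n n)) (even (suc n))

  16^n≡4^[n+n] : ∀ n → 16 ^ n ≡ 4 ^ (n + n)
  16^n≡4^[n+n] n = trans (^-*-assoc 4 2 n) (cong (λ m → 4 ^ (n + m)) (+-identityʳ n))

  middleBinomial-bound : ∀ w → (w C ⌊ w /2⌋) * (w C ⌊ w /2⌋) * w ≤ 4 ^ w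
  middleBinomial-bound w with evenOdd w
  ... | even n rewrite sym (n≡⌊n+n/2⌋ n) = begin
    c * c * (n + n)     ≤⟨ *-monoʳ-≤ (c * c) (m+n≤o⇒m≤o (n + n) (≤-reflexive (split n))) ⟩
    c * c * suc (3 * n) ≤⟨ centralBinomial-bound n ⟩
    16 ^ n              ≡⟨ 16^n≡4^[n+n] n ⟩
    4 ^ (n + n)         ∎
    where
    open ≤-Reasoning
    c : ℕ
    c = centralBinomial n
    split : ∀ n → n + n + suc n ≡ suc (3 * n)
    split = solve-∀
  ... | odd n rewrite sym (n≡⌈n+n/2⌉ n) = ≤-trans ([1+2n]Cn-bound n) (≤-reflexive (cong (4 *_) (16^n≡4^[n+n] n)))

module ListSums where

  open import Data.Bool using (Bool; true; false; if_then_else_)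
  open import Data.List using (List; []; _∷_; _++_; map; concatMap; length; filter)
  open import Data.List.Relation.Unary.All using (All; []; _∷_)
  open import Data.Nat using (ℕ; suc; _+_; _*_; _≤_; z≤n)
  open import Data.Nat.Properties
  open import Algebra.Properties.CommutativeSemigroup +-commutativeSemigroup using (interchange)
  open import Function using (_∘_)
  open import Relation.Nullary using (does)
  open import Relation.Unary using (Decidable)
  open import Relation.Binary.PropositionalEquality

  module _ {A : Set} where

    sumOver : (A → ℕ) → List A → ℕ
    sumOver f [] = 0
    sumOver f (x ∷ xs) = f x + sumOver f xs

    count : (A → Bool) → List A → ℕ
    count p = sumOver (λ x → if p x then 1 else 0)

    sumOver-++ : ∀ f xs ys → sumOver f (xs ++ ys) ≡ sumOver f xs + sumOver f ys
    sumOver-++ f [] ys = refl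
    sumOver-++ f (x ∷ xs) ys = trans (cong (f x +_) (sumOver-++ f xs ys)) (sym (+-assoc (f x) _ _))

    count-++ : ∀ p xs ys → count p (xs ++ ys) ≡ count p xs + count p ys
    count-++ p = sumOver-++ _

    sumOver-cong-All : ∀ {P : A → Set} {f g} → (∀ {x} → P x → f x ≡ g x) → ∀ {xs} → All P xs → sumOver f xs ≡ sumOver g xs
    sumOver-cong-All f≡g [] = refl
    sumOver-cong-All f≡g (px ∷ pxs) = cong₂ _+_ (f≡g px) (sumOver-cong-All f≡g pxs)

    sumOver-cong : ∀ {f g} → (∀ x → f x ≡ g x) → ∀ xs → sumOver f xs ≡ sumOver g xs
    sumOver-cong f≡g [] = refl
    sumOver-cong f≡g (x ∷ xs) = cong₂ _+_ (f≡g x) (sumOver-cong f≡g xs)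

    count-cong : ∀ {p q} → (∀ x → p x ≡ q x) → ∀ xs → count p xs ≡ count q xs
    count-cong p≡q = sumOver-cong (λ x → cong (λ b → if b then 1 else 0) (p≡q x))

    sumOver-mono-All : ∀ {P : A → Set} {f g} → (∀ {x} → P x → f x ≤ g x) → ∀ {xs} → All P xs → sumOver f xs ≤ sumOver g xs
    sumOver-mono-All f≤g [] = z≤n
    sumOver-mono-All f≤g (px ∷ pxs) = +-mono-≤ (f≤g px) (sumOver-mono-All f≤g pxs)

    sumOver-+ : ∀ f g xs → sumOver (λ x → f x + g x) xs ≡ sumOver f xs + sumOver g xs
    sumOver-+ f g [] = refl
    sumOver-+ f g (x ∷ xs) = trans (cong (f x + g x +_) (sumOver-+ f g xs)) (interchange (f x) (g x) _ _)

    sumOver-*ˡ : ∀ c f xs → sumOver (λ x → c * f x) xs ≡ c * sumOver f xs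
    sumOver-*ˡ c f [] = sym (*-zeroʳ c)
    sumOver-*ˡ c f (x ∷ xs) = trans (cong (c * f x +_) (sumOver-*ˡ c f xs)) (sym (*-distribˡ-+ c (f x) _))

    sumOver-const : ∀ c xs → sumOver (λ _ → c) xs ≡ length xs * c
    sumOver-const c [] = refl
    sumOver-const c (x ∷ xs) = cong (c +_) (sumOver-const c xs)

    sumOver-1 : ∀ xs → sumOver (λ _ → 1) xs ≡ length xs
    sumOver-1 [] = refl
    sumOver-1 (x ∷ xs) = cong suc (sumOver-1 xs)

    length-filter : ∀ {P : A → Set} (P? : Decidable P) xs → length (filter P? xs) ≡ count (does ∘ P?) xs
    length-filter P? [] = refl
    length-filter P? (x ∷ xs) with does (P? x)
    ... | true = cong suc (length-filter P? xs)
    ... | false = length-filter P? xs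

  module _ {A B : Set} where

    sumOver-map : ∀ f (g : A → B) xs → sumOver f (map g xs) ≡ sumOver (f ∘ g) xs
    sumOver-map f g [] = refl
    sumOver-map f g (x ∷ xs) = cong (f (g x) +_) (sumOver-map f g xs)

    sumOver-concatMap : ∀ f (g : A → List B) xs → sumOver f (concatMap g xs) ≡ sumOver (sumOver f ∘ g) xs
    sumOver-concatMap f g [] = refl
    sumOver-concatMap f g (x ∷ xs) = trans (sumOver-++ f (g x) (concatMap g xs)) (cong (sumOver f (g x) +_) (sumOver-concatMap f g xs))

    count-map : ∀ p (g : A → B) xs → count p (map g xs) ≡ count (p ∘ g) xs
    count-map p = sumOver-map _

module SymmetricChains where

  open import Data.Bool using (Bool; if_then_else_)
  open import Data.List using (List; []; _∷_; _++_; map; concatMap; length)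
  import Data.List.Properties as List
  open import Data.List.Relation.Unary.All as All using (All; []; _∷_)
  import Data.List.Relation.Unary.All.Properties as All
  open import Data.List.Relation.Unary.AllPairs as AllPairs using (AllPairs; []; _∷_)
  import Data.List.Relation.Unary.AllPairs.Properties as AllPairs
  open import Data.Nat as ℕ using (ℕ; zero; suc; _≤_; z≤n; s≤s; ⌊_/2⌋)
  import Data.Nat.Properties as ℕ
  open import Data.Nat.Combinatorics using (_C_; nCk+nC[k+1]≡[n+1]C[k+1])
  open import Data.Nat.Tactic.RingSolver using (solve-∀)
  open import Data.Product using (_×_; _,_)
  open import Data.Rational using (ℚ; 0ℚ; _+_; _<_; _>_)
  import Data.Rational.Properties as ℚ
  open import Data.Empty using (⊥-elim)
  open import Function using (_∘_)
  open import Relation.Nullary using (does; yes; no)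
  open import Relation.Nullary.Decidable using (dec-true; dec-false)
  open import Relation.Binary.PropositionalEquality
  open ListSums
  open import Algebra.Properties.CommutativeSemigroup ℕ.+-commutativeSemigroup using (xy∙z≈y∙xz)

  -- A subset of ds is recorded only by its size and its sum.
  addElement : ℚ → ℕ × ℚ → ℕ × ℚ
  addElement d (r , v) = suc r , v + d

  subsetSums : List ℚ → List (ℕ × ℚ)
  subsetSums [] = (0 , 0ℚ) ∷ []
  subsetSums (d ∷ ds) = subsetSums ds ++ map (addElement d) (subsetSums ds)

  hasRank : ℕ → ℕ × ℚ → Bool
  hasRank m (r , v) = does (r ℕ.≟ m)

  hasValue : ℚ → ℕ × ℚ → Bool
  hasValue c (r , v) = does (v ℚ.≟ c)

  -- Subsets of consecutive sizes base, …, base + length rest, given by their sums from the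
  -- largest one down; ranked attaches the sizes.
  record Chain : Set where
    constructor chain
    field
      base : ℕ
      top  : ℚ
      rest : List ℚ

  ranked : ℕ → List ℚ → List (ℕ × ℚ)
  ranked r [] = []
  ranked r (u ∷ us) = (r ℕ.+ length us , u) ∷ ranked r us

  members : Chain → List (ℕ × ℚ)
  members (chain r u us) = ranked r (u ∷ us)

  -- De Bruijn's construction: a chain C over ds gives the chains C ∪ {top C ∪ {d}} and
  -- {S ∪ {d} | S ∈ C, S ≠ top C} over d ∷ ds.
  shiftedBelowTop : ℚ → ℕ → List ℚ → List Chain
  shiftedBelowTop d r [] = []
  shiftedBelowTop d r (u ∷ us) = chain (suc r) (u + d) (map (_+ d) us) ∷ []

  extend : ℚ → Chain → List Chain
  extend d (chain r u us) = chain r (u + d) (u ∷ us) ∷ shiftedBelowTop d r us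

  chains : List ℚ → List Chain
  chains [] = chain 0 0ℚ [] ∷ []
  chains (d ∷ ds) = concatMap (extend d) (chains ds)

  map-addElement-ranked : ∀ d r us → map (addElement d) (ranked r us) ≡ ranked (suc r) (map (_+ d) us)
  map-addElement-ranked d r [] = refl
  map-addElement-ranked d r (u ∷ us) =
    cong₂ (λ l xs → (suc (r ℕ.+ l) , u + d) ∷ xs) (sym (List.length-map (_+ d) us)) (map-addElement-ranked d r us)

  members-shiftedBelowTop : ∀ d r us → concatMap members (shiftedBelowTop d r us) ≡ ranked (suc r) (map (_+ d) us)
  members-shiftedBelowTop d r [] = refl
  members-shiftedBelowTop d r (u ∷ us) = List.++-identityʳ _

  count-extend : ∀ p d ch → count p (concatMap members (extend d ch)) ≡ count p (members ch) ℕ.+ count (p ∘ addElement d) (members ch)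
  count-extend p d (chain r u us) = begin
    count p (concatMap members (extend d (chain r u us)))
      ≡⟨ count-++ p (members (chain r (u + d) (u ∷ us))) _ ⟩
    count p ((r ℕ.+ suc (length us) , u + d) ∷ ranked r (u ∷ us)) ℕ.+ count p (concatMap members (shiftedBelowTop d r us))
      ≡⟨ cong₂ (λ l xs → count p ((l , u + d) ∷ ranked r (u ∷ us)) ℕ.+ count p xs) (ℕ.+-suc r _) (members-shiftedBelowTop d r us) ⟩
    count p (top′ ∷ ranked r (u ∷ us)) ℕ.+ count p (ranked (suc r) (map (_+ d) us))
      ≡⟨ xy∙z≈y∙xz (if p top′ then 1 else 0) (count p (ranked r (u ∷ us))) _ ⟩
    count p (ranked r (u ∷ us)) ℕ.+ count p (top′ ∷ ranked (suc r) (map (_+ d) us))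
      ≡⟨ cong (λ xs → count p (ranked r (u ∷ us)) ℕ.+ count p (top′ ∷ xs)) (sym (map-addElement-ranked d r us)) ⟩
    count p (ranked r (u ∷ us)) ℕ.+ count p (map (addElement d) (ranked r (u ∷ us)))
      ≡⟨ cong (count p (ranked r (u ∷ us)) ℕ.+_) (count-map p (addElement d) (ranked r (u ∷ us))) ⟩
    count p (members (chain r u us)) ℕ.+ count (p ∘ addElement d) (members (chain r u us)) ∎
    where
    open ≡-Reasoning
    top′ : ℕ × ℚ
    top′ = (suc (r ℕ.+ length us) , u + d)

  count-chains : ∀ p ds → count p (concatMap members (chains ds)) ≡ count p (subsetSums ds)
  count-chains p [] = refl
  count-chains p (d ∷ ds) = begin
    count p (concatMap members (concatMap (extend d) cs))
      ≡⟨ sumOver-concatMap _ members (concatMap (extend d) cs) ⟩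
    sumOver (count p ∘ members) (concatMap (extend d) cs)
      ≡⟨ sumOver-concatMap _ (extend d) cs ⟩
    sumOver (λ ch → sumOver (count p ∘ members) (extend d ch)) cs
      ≡⟨ sumOver-cong (λ ch → trans (sym (sumOver-concatMap _ members (extend d ch))) (count-extend p d ch)) cs ⟩
    sumOver (λ ch → count p (members ch) ℕ.+ count (p ∘ addElement d) (members ch)) cs
      ≡⟨ sumOver-+ _ _ cs ⟩
    sumOver (count p ∘ members) cs ℕ.+ sumOver (count (p ∘ addElement d) ∘ members) cs
      ≡⟨ cong₂ ℕ._+_ (sym (sumOver-concatMap _ members cs)) (sym (sumOver-concatMap _ members cs)) ⟩
    count p (concatMap members cs) ℕ.+ count (p ∘ addElement d) (concatMap members cs)
      ≡⟨ cong₂ ℕ._+_ (count-chains p ds) (count-chains (p ∘ addElement d) ds) ⟩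
    count p (subsetSums ds) ℕ.+ count (p ∘ addElement d) (subsetSums ds)
      ≡⟨ cong (count p (subsetSums ds) ℕ.+_) (sym (count-map p (addElement d) (subsetSums ds))) ⟩
    count p (subsetSums ds) ℕ.+ count p (map (addElement d) (subsetSums ds))
      ≡⟨ sym (count-++ p (subsetSums ds) _) ⟩
    count p (subsetSums (d ∷ ds)) ∎
    where
    open ≡-Reasoning
    cs : List Chain
    cs = chains ds

  -- Bottom and top size add up to w, and the sums decrease strictly from the top down.
  SymmetricChain : ℕ → Chain → Set
  SymmetricChain w (chain r u us) = (r ℕ.+ r ℕ.+ length us ≡ w) × AllPairs _>_ (u ∷ us)

  extend-symmetric : ∀ {d w} → 0ℚ < d → ∀ ch → SymmetricChain w ch → All (SymmetricChain (suc w)) (extend d ch)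
  extend-symmetric {d} {w} 0<d (chain r u us) (r+r+l≡w , u>us ∷ us↓) =
    (trans (ℕ.+-suc (r ℕ.+ r) (length us)) (cong suc r+r+l≡w) , (u+d>u ∷ All.map (λ u>x → ℚ.<-trans u>x u+d>u) u>us) ∷ u>us ∷ us↓)
    ∷ belowTop us r+r+l≡w us↓
    where
    u+d>u : u + d > u
    u+d>u = subst (_< u + d) (ℚ.+-identityʳ u) (ℚ.+-monoʳ-< u 0<d)
    belowTop : ∀ us → r ℕ.+ r ℕ.+ length us ≡ w → AllPairs _>_ us → All (SymmetricChain (suc w)) (shiftedBelowTop d r us)
    belowTop [] _ _ = []
    belowTop (u′ ∷ us′) r+r+l≡w us↓ =
      (trans (cong (suc r ℕ.+ suc r ℕ.+_) (List.length-map (_+ d) us′)) (trans (ranks r (length us′)) (cong suc r+r+l≡w)) ,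
       AllPairs.map⁺ (AllPairs.map (ℚ.+-monoˡ-< d) us↓))
      ∷ []
      where
      ranks : ∀ r l → suc r ℕ.+ suc r ℕ.+ l ≡ suc (r ℕ.+ r ℕ.+ suc l)
      ranks = solve-∀

  chains-symmetric : ∀ {ds} → All (0ℚ <_) ds → All (SymmetricChain (length ds)) (chains ds)
  chains-symmetric [] = (refl , [] ∷ []) ∷ []
  chains-symmetric {d ∷ ds} (0<d ∷ 0<ds) =
    All.concat⁺ (All.map⁺ (All.map (λ {ch} → extend-symmetric 0<d ch) (chains-symmetric 0<ds)))

  count-hasRank-subsetSums : ∀ ds m → count (hasRank m) (subsetSums ds) ≡ length ds C m
  count-hasRank-subsetSums [] zero = refl
  count-hasRank-subsetSums [] (suc m) = refl
  count-hasRank-subsetSums (d ∷ ds) zero = begin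
    count (hasRank 0) (subsetSums ds ++ map (addElement d) (subsetSums ds))
      ≡⟨ count-++ (hasRank 0) (subsetSums ds) _ ⟩
    count (hasRank 0) (subsetSums ds) ℕ.+ count (hasRank 0) (map (addElement d) (subsetSums ds))
      ≡⟨ cong₂ ℕ._+_ (count-hasRank-subsetSums ds 0) (count-map (hasRank 0) (addElement d) (subsetSums ds)) ⟩
    1 ℕ.+ sumOver (λ _ → 0) (subsetSums ds)
      ≡⟨ cong suc (trans (sumOver-const 0 (subsetSums ds)) (ℕ.*-zeroʳ (length (subsetSums ds)))) ⟩
    1 ∎
    where open ≡-Reasoning
  count-hasRank-subsetSums (d ∷ ds) (suc m) = begin
    count (hasRank (suc m)) (subsetSums ds ++ map (addElement d) (subsetSums ds))
      ≡⟨ count-++ (hasRank (suc m)) (subsetSums ds) _ ⟩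
    count (hasRank (suc m)) (subsetSums ds) ℕ.+ count (hasRank (suc m)) (map (addElement d) (subsetSums ds))
      ≡⟨ cong₂ ℕ._+_ (count-hasRank-subsetSums ds (suc m)) (count-map (hasRank (suc m)) (addElement d) (subsetSums ds)) ⟩
    length ds C suc m ℕ.+ count (hasRank m) (subsetSums ds)
      ≡⟨ cong (length ds C suc m ℕ.+_) (count-hasRank-subsetSums ds m) ⟩
    length ds C suc m ℕ.+ length ds C m
      ≡⟨ ℕ.+-comm (length ds C suc m) _ ⟩
    length ds C m ℕ.+ length ds C suc m
      ≡⟨ nCk+nC[k+1]≡[n+1]C[k+1] (length ds) m ⟩
    suc (length ds) C suc m ∎
    where open ≡-Reasoning

  count-hasRank-below : ∀ m r us → r ℕ.+ length us ≤ m → count (hasRank m) (ranked r us) ≡ 0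
  count-hasRank-below m r [] _ = refl
  count-hasRank-below m r (v ∷ vs) r+l+1≤m
    rewrite dec-false (r ℕ.+ length vs ℕ.≟ m) (ℕ.<⇒≢ (subst (ℕ._≤ m) (ℕ.+-suc r (length vs)) r+l+1≤m))
    = count-hasRank-below m r vs (ℕ.≤-trans (ℕ.+-monoʳ-≤ r (ℕ.n≤1+n (length vs))) r+l+1≤m)

  count-hasRank-within : ∀ m r us → r ≤ m → m ℕ.< r ℕ.+ length us → count (hasRank m) (ranked r us) ≡ 1
  count-hasRank-within m r [] r≤m m<r+0 = ⊥-elim (ℕ.<-irrefl refl (ℕ.≤-<-trans r≤m (subst (m ℕ.<_) (ℕ.+-identityʳ r) m<r+0)))
  count-hasRank-within m r (v ∷ vs) r≤m m<r+l+1 with r ℕ.+ length vs ℕ.≟ m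
  ... | yes r+l≡m rewrite dec-true (r ℕ.+ length vs ℕ.≟ m) r+l≡m =
    cong suc (count-hasRank-below m r vs (ℕ.≤-reflexive r+l≡m))
  ... | no r+l≢m rewrite dec-false (r ℕ.+ length vs ℕ.≟ m) r+l≢m = count-hasRank-within m r vs r≤m
                     (ℕ.≤∧≢⇒< (ℕ.≤-pred (subst (m ℕ.<_) (ℕ.+-suc r (length vs)) m<r+l+1)) (r+l≢m ∘ sym))

  ⌊r+r+l/2⌋≡r+⌊l/2⌋ : ∀ r l → ⌊ r ℕ.+ r ℕ.+ l /2⌋ ≡ r ℕ.+ ⌊ l /2⌋
  ⌊r+r+l/2⌋≡r+⌊l/2⌋ zero l = refl
  ⌊r+r+l/2⌋≡r+⌊l/2⌋ (suc r) l =
    trans (cong (λ n → ⌊ suc (n ℕ.+ l) /2⌋) (ℕ.+-suc r r)) (cong suc (⌊r+r+l/2⌋≡r+⌊l/2⌋ r l))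

  symmetricChain-middle : ∀ w ch → SymmetricChain w ch → count (hasRank ⌊ w /2⌋) (members ch) ≡ 1
  symmetricChain-middle w (chain r u us) (refl , _) rewrite ⌊r+r+l/2⌋≡r+⌊l/2⌋ r (length us) =
    count-hasRank-within (r ℕ.+ ⌊ length us /2⌋) r (u ∷ us)
      (ℕ.m≤m+n r _) (ℕ.+-monoʳ-< r (s≤s (ℕ.⌊n/2⌋≤n (length us))))

  count-hasValue-above : ∀ c r us → All (_< c) us → count (hasValue c) (ranked r us) ≡ 0
  count-hasValue-above c r [] [] = refl
  count-hasValue-above c r (v ∷ vs) (v<c ∷ vs<c) rewrite dec-false (v ℚ.≟ c) (ℚ.<⇒≢ v<c) =
    count-hasValue-above c r vs vs<c

  count-hasValue-descending : ∀ c r us → AllPairs _>_ us → count (hasValue c) (ranked r us) ≤ 1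
  count-hasValue-descending c r [] [] = z≤n
  count-hasValue-descending c r (v ∷ vs) (v>vs ∷ vs↓) with v ℚ.≟ c
  ... | yes refl = ℕ.≤-reflexive (cong suc (count-hasValue-above v r vs v>vs))
  ... | no _ = count-hasValue-descending c r vs vs↓

  length-chains : ∀ {ds} → All (0ℚ <_) ds → length (chains ds) ≡ length ds C ⌊ length ds /2⌋
  length-chains {ds} 0<ds = begin
    length (chains ds)
      ≡⟨ sym (sumOver-1 (chains ds)) ⟩
    sumOver (λ _ → 1) (chains ds)
      ≡⟨ sumOver-cong-All (λ {ch} sym-ch → sym (symmetricChain-middle (length ds) ch sym-ch)) (chains-symmetric 0<ds) ⟩
    sumOver (count (hasRank middle) ∘ members) (chains ds)
      ≡⟨ sym (sumOver-concatMap _ members (chains ds)) ⟩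
    count (hasRank middle) (concatMap members (chains ds))
      ≡⟨ count-chains (hasRank middle) ds ⟩
    count (hasRank middle) (subsetSums ds)
      ≡⟨ count-hasRank-subsetSums ds middle ⟩
    length ds C middle ∎
    where
    open ≡-Reasoning
    middle : ℕ
    middle = ⌊ length ds /2⌋

  littlewood-offord : ∀ {ds} → All (0ℚ <_) ds → ∀ c → count (hasValue c) (subsetSums ds) ≤ length ds C ⌊ length ds /2⌋
  littlewood-offord {ds} 0<ds c = begin
    count (hasValue c) (subsetSums ds)
      ≡⟨ sym (count-chains (hasValue c) ds) ⟩
    count (hasValue c) (concatMap members (chains ds))
      ≡⟨ sumOver-concatMap _ members (chains ds) ⟩
    sumOver (count (hasValue c) ∘ members) (chains ds)
      ≤⟨ sumOver-mono-All (λ {ch} → value-once ch) (chains-symmetric 0<ds) ⟩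
    sumOver (λ _ → 1) (chains ds)
      ≡⟨ sumOver-1 (chains ds) ⟩
    length (chains ds)
      ≡⟨ length-chains 0<ds ⟩
    length ds C ⌊ length ds /2⌋ ∎
    where
    open ℕ.≤-Reasoning
    value-once : ∀ ch → SymmetricChain (length ds) ch → count (hasValue c) (members ch) ≤ 1
    value-once (chain r u us) (_ , u∷us↓) = count-hasValue-descending c r (u ∷ us) u∷us↓

module SubsetSums where

  open import Data.List using (List; []; _∷_; length)
  open import Data.List.Relation.Unary.All using (All; []; _∷_)
  open import Data.Nat as ℕ using (ℕ; suc; _≤_; _^_; ⌊_/2⌋)
  import Data.Nat.Properties as ℕ
  open import Data.Nat.Combinatorics using (_C_)
  open import Data.Nat.Tactic.RingSolver using (solve-∀)
  open import Data.Product using (_,_)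
  open import Data.Rational using (ℚ; 0ℚ; _+_; _-_; -_; _<_)
  import Data.Rational.Properties as ℚ
  open import Data.Rational.Solver using (module +-*-Solver)
  open import Function.Bundles using (mk⇔)
  open import Relation.Binary.Definitions using (tri<; tri≈; tri>)
  open import Relation.Nullary.Decidable using (does; does-⇔)
  open import Relation.Binary.PropositionalEquality
  open ListSums
  open SymmetricChains
  open +-*-Solver

  subsetSumCount : List ℚ → ℚ → ℕ
  subsetSumCount ds c = count (hasValue c) (subsetSums ds)

  ≟-shift : ∀ v d c → does (v + d ℚ.≟ c) ≡ does (v ℚ.≟ c - d)
  ≟-shift v d c = does-⇔ (mk⇔ (λ v+d≡c → trans (cancel v d) (cong (_- d) v+d≡c)) (λ v≡c-d → trans (cong (_+ d) v≡c-d) (uncancel c d))) (v + d ℚ.≟ c) (v ℚ.≟ c - d)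
    where
    cancel : ∀ v d → v ≡ v + d - d
    cancel = solve 2 (λ v d → v := v :+ d :- d) refl
    uncancel : ∀ c d → c - d + d ≡ c
    uncancel = solve 2 (λ c d → c :- d :+ d := c) refl

  subsetSumCount-cons : ∀ d ds c → subsetSumCount (d ∷ ds) c ≡ subsetSumCount ds c ℕ.+ subsetSumCount ds (c - d)
  subsetSumCount-cons d ds c = trans (count-++ (hasValue c) (subsetSums ds) _) (cong (subsetSumCount ds c ℕ.+_)
    (trans (count-map (hasValue c) (addElement d) (subsetSums ds)) (count-cong (λ (_ , v) → ≟-shift v d c) (subsetSums ds))))

  nonzeroMagnitudes : List ℚ → List ℚ
  nonzeroMagnitudes [] = []
  nonzeroMagnitudes (d ∷ ds) with ℚ.<-cmp d 0ℚ
  ... | tri< _ _ _ = - d ∷ nonzeroMagnitudes ds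
  ... | tri≈ _ _ _ = nonzeroMagnitudes ds
  ... | tri> _ _ _ = d ∷ nonzeroMagnitudes ds

  zeroCount : List ℚ → ℕ
  zeroCount [] = 0
  zeroCount (d ∷ ds) with ℚ.<-cmp d 0ℚ
  ... | tri< _ _ _ = zeroCount ds
  ... | tri≈ _ _ _ = suc (zeroCount ds)
  ... | tri> _ _ _ = zeroCount ds

  negativeMass : List ℚ → ℚ
  negativeMass [] = 0ℚ
  negativeMass (d ∷ ds) with ℚ.<-cmp d 0ℚ
  ... | tri< _ _ _ = - d + negativeMass ds
  ... | tri≈ _ _ _ = negativeMass ds
  ... | tri> _ _ _ = negativeMass ds

  nonzeroMagnitudes-positive : ∀ ds → All (0ℚ <_) (nonzeroMagnitudes ds)
  nonzeroMagnitudes-positive [] = []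
  nonzeroMagnitudes-positive (d ∷ ds) with ℚ.<-cmp d 0ℚ
  ... | tri< d<0 _ _ = ℚ.neg-antimono-< d<0 ∷ nonzeroMagnitudes-positive ds
  ... | tri≈ _ _ _ = nonzeroMagnitudes-positive ds
  ... | tri> _ _ d>0 = d>0 ∷ nonzeroMagnitudes-positive ds

  -- A zero entry doubles every count; taking a negative d is not taking −d, which shifts the
  -- target by −d.
  subsetSumCount-normalise : ∀ ds c →
    subsetSumCount ds c ≡ 2 ^ zeroCount ds ℕ.* subsetSumCount (nonzeroMagnitudes ds) (c + negativeMass ds)
  subsetSumCount-normalise [] c = sym (trans (ℕ.+-identityʳ _) (cong (subsetSumCount []) (ℚ.+-identityʳ c)))
  subsetSumCount-normalise (d ∷ ds) c with ℚ.<-cmp d 0ℚ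
  ... | tri≈ _ refl _ = begin
    subsetSumCount (0ℚ ∷ ds) c                         ≡⟨ subsetSumCount-cons 0ℚ ds c ⟩
    subsetSumCount ds c ℕ.+ subsetSumCount ds (c - 0ℚ) ≡⟨ cong (λ c′ → subsetSumCount ds c ℕ.+ subsetSumCount ds c′) (ℚ.+-identityʳ c) ⟩
    subsetSumCount ds c ℕ.+ subsetSumCount ds c         ≡⟨ cong (λ n → n ℕ.+ n) (subsetSumCount-normalise ds c) ⟩
    P ℕ.* N (c + o) ℕ.+ P ℕ.* N (c + o)                  ≡⟨ double P (N (c + o)) ⟩
    2 ℕ.* P ℕ.* N (c + o)                               ∎
    where
    open ≡-Reasoning
    P : ℕ
    P = 2 ^ zeroCount ds
    N : ℚ → ℕ
    N = subsetSumCount (nonzeroMagnitudes ds)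
    o : ℚ
    o = negativeMass ds
    double : ∀ p x → p ℕ.* x ℕ.+ p ℕ.* x ≡ 2 ℕ.* p ℕ.* x
    double = solve-∀
  ... | tri> _ _ _ = begin
    subsetSumCount (d ∷ ds) c
      ≡⟨ subsetSumCount-cons d ds c ⟩
    subsetSumCount ds c ℕ.+ subsetSumCount ds (c - d)
      ≡⟨ cong₂ ℕ._+_ (subsetSumCount-normalise ds c) (subsetSumCount-normalise ds (c - d)) ⟩
    P ℕ.* N (c + o) ℕ.+ P ℕ.* N (c - d + o)
      ≡⟨ cong (λ c′ → P ℕ.* N (c + o) ℕ.+ P ℕ.* N c′) (reorder c d o) ⟩
    P ℕ.* N (c + o) ℕ.+ P ℕ.* N (c + o - d)
      ≡⟨ sym (ℕ.*-distribˡ-+ P _ _) ⟩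
    P ℕ.* (N (c + o) ℕ.+ N (c + o - d))
      ≡⟨ cong (P ℕ.*_) (sym (subsetSumCount-cons d (nonzeroMagnitudes ds) (c + o))) ⟩
    P ℕ.* subsetSumCount (d ∷ nonzeroMagnitudes ds) (c + o) ∎
    where
    open ≡-Reasoning
    P : ℕ
    P = 2 ^ zeroCount ds
    N : ℚ → ℕ
    N = subsetSumCount (nonzeroMagnitudes ds)
    o : ℚ
    o = negativeMass ds
    reorder : ∀ c d o → c - d + o ≡ c + o - d
    reorder = solve 3 (λ c d o → c :- d :+ o := c :+ o :- d) refl
  ... | tri< _ _ _ = begin
    subsetSumCount (d ∷ ds) c
      ≡⟨ subsetSumCount-cons d ds c ⟩
    subsetSumCount ds c ℕ.+ subsetSumCount ds (c - d)
      ≡⟨ cong₂ ℕ._+_ (subsetSumCount-normalise ds c) (subsetSumCount-normalise ds (c - d)) ⟩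
    P ℕ.* N (c + o) ℕ.+ P ℕ.* N (c - d + o)
      ≡⟨ cong₂ (λ c′ c″ → P ℕ.* N c′ ℕ.+ P ℕ.* N c″) (sym (flipped c d o)) (regroup c d o) ⟩
    P ℕ.* N (c + (- d + o) - - d) ℕ.+ P ℕ.* N (c + (- d + o))
      ≡⟨ ℕ.+-comm (P ℕ.* N (c + (- d + o) - - d)) _ ⟩
    P ℕ.* N (c + (- d + o)) ℕ.+ P ℕ.* N (c + (- d + o) - - d)
      ≡⟨ sym (ℕ.*-distribˡ-+ P _ _) ⟩
    P ℕ.* (N (c + (- d + o)) ℕ.+ N (c + (- d + o) - - d))
      ≡⟨ cong (P ℕ.*_) (sym (subsetSumCount-cons (- d) (nonzeroMagnitudes ds) (c + (- d + o)))) ⟩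
    P ℕ.* subsetSumCount (- d ∷ nonzeroMagnitudes ds) (c + (- d + o)) ∎
    where
    open ≡-Reasoning
    P : ℕ
    P = 2 ^ zeroCount ds
    N : ℚ → ℕ
    N = subsetSumCount (nonzeroMagnitudes ds)
    o : ℚ
    o = negativeMass ds
    flipped : ∀ c d o → c + (- d + o) - - d ≡ c + o
    flipped = solve 3 (λ c d o → c :+ (:- d :+ o) :- (:- d) := c :+ o) refl
    regroup : ∀ c d o → c - d + o ≡ c + (- d + o)
    regroup = solve 3 (λ c d o → c :- d :+ o := c :+ (:- d :+ o)) refl

  subsetSumCount-bound : ∀ ds c → let m = length (nonzeroMagnitudes ds) in
    subsetSumCount ds c ≤ 2 ^ zeroCount ds ℕ.* (m C ⌊ m /2⌋)
  subsetSumCount-bound ds c = subst (_≤ _) (sym (subsetSumCount-normalise ds c))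
    (ℕ.*-monoʳ-≤ (2 ^ zeroCount ds) (littlewood-offord (nonzeroMagnitudes-positive ds) (c + negativeMass ds)))

module PairAveraging where

  open import Defs
  open import Data.Bool using (Bool; if_then_else_)
  open import Data.Integer as ℤ using (ℤ; +_)
  import Data.Integer.Properties as ℤ
  open import Data.Integer.GCD using () renaming (gcd to ℤgcd)
  open import Data.List using (List; []; _∷_; _++_; map; concatMap; length; filter)
  import Data.List.Properties as List
  open import Data.List.Relation.Unary.All using (All; []; _∷_)
  import Data.List.Relation.Unary.All.Properties as All
  open import Data.List.Relation.Unary.Unique.Propositional using (Unique; []; _∷_)
  open import Data.Nat as ℕ using (ℕ; zero; suc; pred; _≤_; _^_; ⌊_/2⌋)
  import Data.Nat.Properties as ℕ
  open import Data.Nat.Combinatorics using (_C_)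
  open import Data.Nat.Tactic.RingSolver using (solve-∀)
  open import Data.Product using (_×_; _,_; proj₁; proj₂; uncurry)
  open import Data.Rational using (ℚ; 0ℚ; 1ℚ; _+_; _-_; _*_; 1/_; ↥_; ≢-nonZero)
  import Data.Rational.Properties as ℚ
  open import Data.Rational.Solver using (module +-*-Solver)
  open import Data.Vec using (Vec; []; _∷_; toList)
  open import Data.Vec.Relation.Unary.All as VecAll using () renaming (All to AllVec)
  open import Algebra.Properties.CommutativeSemigroup ℕ.*-commutativeSemigroup using (x∙yz≈y∙xz)
  open import Function using (_∘_)
  open import Relation.Binary.PropositionalEquality
  open import Relation.Binary.Definitions using (tri<; tri≈; tri>)
  open import Relation.Nullary using (does; yes; no)
  open import Relation.Nullary.Negation using (contradiction)
  open ListSums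
  open SubsetSums
  open +-*-Solver

  module _ {A : Set} where

    pairs : List A → List (A × A)
    pairs [] = []
    pairs (x ∷ xs) = map (x ,_) xs ++ pairs xs

    pairs-distinct : ∀ {xs} → Unique xs → All (uncurry _≢_) (pairs xs)
    pairs-distinct [] = []
    pairs-distinct {x ∷ xs} (x∉xs ∷ xs!) = All.++⁺ (All.map⁺ x∉xs) (pairs-distinct xs!)

    2*length-pairs : ∀ xs → 2 ℕ.* length (pairs xs) ≡ length xs ℕ.* pred (length xs)
    2*length-pairs [] = refl
    2*length-pairs (x ∷ []) = refl
    2*length-pairs (x ∷ y ∷ ys) = begin
      2 ℕ.* length (map (x ,_) (y ∷ ys) ++ pairs (y ∷ ys))
        ≡⟨ cong (2 ℕ.*_) (trans (List.length-++ (map (x ,_) (y ∷ ys))) (cong (ℕ._+ length (pairs (y ∷ ys))) (List.length-map (x ,_) (y ∷ ys)))) ⟩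
      2 ℕ.* (suc (length ys) ℕ.+ length (pairs (y ∷ ys)))
        ≡⟨ ℕ.*-distribˡ-+ 2 (suc (length ys)) _ ⟩
      2 ℕ.* suc (length ys) ℕ.+ 2 ℕ.* length (pairs (y ∷ ys))
        ≡⟨ cong (2 ℕ.* suc (length ys) ℕ.+_) (2*length-pairs (y ∷ ys)) ⟩
      2 ℕ.* suc (length ys) ℕ.+ suc (length ys) ℕ.* length ys
        ≡⟨ collect (length ys) ⟩
      suc (suc (length ys)) ℕ.* suc (length ys) ∎
      where
      open ≡-Reasoning
      collect : ∀ l → 2 ℕ.* suc l ℕ.+ suc l ℕ.* l ≡ suc (suc l) ℕ.* suc l
      collect = solve-∀

    sumOver-pairs : ∀ f xs → sumOver (λ (x , y) → f x ℕ.+ f y) (pairs xs) ≡ pred (length xs) ℕ.* sumOver f xs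
    sumOver-pairs f [] = refl
    sumOver-pairs f (x ∷ xs) = begin
      sumOver g (map (x ,_) xs ++ pairs xs)
        ≡⟨ sumOver-++ g (map (x ,_) xs) (pairs xs) ⟩
      sumOver g (map (x ,_) xs) ℕ.+ sumOver g (pairs xs)
        ≡⟨ cong₂ ℕ._+_ (trans (sumOver-map g (x ,_) xs) (sumOver-+ (λ _ → f x) f xs)) (sumOver-pairs f xs) ⟩
      sumOver (λ _ → f x) xs ℕ.+ sumOver f xs ℕ.+ pred (length xs) ℕ.* sumOver f xs
        ≡⟨ cong (λ s → s ℕ.+ sumOver f xs ℕ.+ pred (length xs) ℕ.* sumOver f xs) (sumOver-const (f x) xs) ⟩
      length xs ℕ.* f x ℕ.+ sumOver f xs ℕ.+ pred (length xs) ℕ.* sumOver f xs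
        ≡⟨ collect xs ⟩
      length xs ℕ.* (f x ℕ.+ sumOver f xs) ∎
      where
      open ≡-Reasoning
      g : A × A → ℕ
      g (x , y) = f x ℕ.+ f y
      collect : ∀ ys → length ys ℕ.* f x ℕ.+ sumOver f ys ℕ.+ pred (length ys) ℕ.* sumOver f ys ≡ length ys ℕ.* (f x ℕ.+ sumOver f ys)
      collect [] = refl
      collect ys@(_ ∷ ys′) = distribute (length ys′) (f x) (sumOver f ys)
        where
        distribute : ∀ l a s → suc l ℕ.* a ℕ.+ s ℕ.+ l ℕ.* s ≡ suc l ℕ.* (a ℕ.+ s)
        distribute = solve-∀

  dot-∷-≟ : ∀ {n} a x (as : Vec ℤ n) s b → does (dot (a ∷ as) (x ∷ s) ℚ.≟ b) ≡ does (dot as s ℚ.≟ b - ℤtoℚ a * x)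
  dot-∷-≟ a x as s b = trans (cong (λ v → does (v ℚ.≟ b)) (ℚ.+-comm (ℤtoℚ a * x) (dot as s))) (≟-shift (dot as s) (ℤtoℚ a * x) b)

  countSol-[] : ∀ W b → countSol W [] b ≡ (if does (0ℚ ℚ.≟ b) then 1 else 0)
  countSol-[] W b = trans (length-filter (λ s → dot [] s ℚ.≟ b) ([] ∷ [])) (ℕ.+-identityʳ _)

  countSol-∷ : ∀ {n} W a (as : Vec ℤ n) b → countSol W (a ∷ as) b ≡ sumOver (λ x → countSol W as (b - ℤtoℚ a * x)) W
  countSol-∷ {n} W a as b = begin
    countSol W (a ∷ as) b
      ≡⟨ length-filter (λ s → dot (a ∷ as) s ℚ.≟ b) (powVec W (suc n)) ⟩
    count solves (concatMap (λ x → map (x ∷_) (powVec W n)) W)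
      ≡⟨ sumOver-concatMap _ (λ x → map (x ∷_) (powVec W n)) W ⟩
    sumOver (λ x → count solves (map (x ∷_) (powVec W n))) W
      ≡⟨ sumOver-cong (λ x → trans (count-map solves (x ∷_) (powVec W n)) (count-cong (λ s → dot-∷-≟ a x as s b) (powVec W n))) W ⟩
    sumOver (λ x → count (λ s → does (dot as s ℚ.≟ b - ℤtoℚ a * x)) (powVec W n)) W
      ≡⟨ sumOver-cong (λ x → sym (length-filter (λ s → dot as s ℚ.≟ b - ℤtoℚ a * x) (powVec W n))) W ⟩
    sumOver (λ x → countSol W as (b - ℤtoℚ a * x)) W ∎
    where
    open ≡-Reasoning
    solves : Vec ℚ (suc n) → Bool
    solves s = does (dot (a ∷ as) s ℚ.≟ b)

  pairCount : ∀ {n} → Vec (ℚ × ℚ) n → Vec ℤ n → ℚ → ℕ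
  pairCount [] [] b = if does (0ℚ ℚ.≟ b) then 1 else 0
  pairCount ((x , y) ∷ ps) (a ∷ as) b = pairCount ps as (b - ℤtoℚ a * x) ℕ.+ pairCount ps as (b - ℤtoℚ a * y)

  sumOver-powVec-∷ : ∀ {A : Set} (L : List A) n (f : Vec A (suc n) → ℕ) →
    sumOver f (powVec L (suc n)) ≡ sumOver (λ x → sumOver (f ∘ (x ∷_)) (powVec L n)) L
  sumOver-powVec-∷ L n f = trans (sumOver-concatMap f (λ x → map (x ∷_) (powVec L n)) L) (sumOver-cong (λ x → sumOver-map f (x ∷_) (powVec L n)) L)

  sumOver-pairCount : ∀ W {n} (as : Vec ℤ n) b →
    sumOver (λ ps → pairCount ps as b) (powVec (pairs W) n) ≡ pred (length W) ^ n ℕ.* countSol W as b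
  sumOver-pairCount W [] b = trans (ℕ.+-identityʳ _) (sym (trans (ℕ.*-identityˡ _) (countSol-[] W b)))
  sumOver-pairCount W {suc n} (a ∷ as) b = begin
    sumOver (λ ps → pairCount ps (a ∷ as) b) (powVec (pairs W) (suc n))
      ≡⟨ sumOver-powVec-∷ (pairs W) n (λ ps → pairCount ps (a ∷ as) b) ⟩
    sumOver (λ (x , y) → sumOver (λ ps → pairCount ps as (b - ℤtoℚ a * x) ℕ.+ pairCount ps as (b - ℤtoℚ a * y)) (powVec (pairs W) n)) (pairs W)
      ≡⟨ sumOver-cong (λ (x , y) → sumOver-+ _ _ (powVec (pairs W) n)) (pairs W) ⟩
    sumOver (λ (x , y) → F x ℕ.+ F y) (pairs W)
      ≡⟨ sumOver-pairs F W ⟩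
    k-1 ℕ.* sumOver F W
      ≡⟨ cong (k-1 ℕ.*_) (sumOver-cong (λ x → sumOver-pairCount W as (b - ℤtoℚ a * x)) W) ⟩
    k-1 ℕ.* sumOver (λ x → k-1 ^ n ℕ.* countSol W as (b - ℤtoℚ a * x)) W
      ≡⟨ cong (k-1 ℕ.*_) (sumOver-*ˡ (k-1 ^ n) (λ x → countSol W as (b - ℤtoℚ a * x)) W) ⟩
    k-1 ℕ.* (k-1 ^ n ℕ.* sumOver (λ x → countSol W as (b - ℤtoℚ a * x)) W)
      ≡⟨ cong (λ c → k-1 ℕ.* (k-1 ^ n ℕ.* c)) (sym (countSol-∷ W a as b)) ⟩
    k-1 ℕ.* (k-1 ^ n ℕ.* countSol W (a ∷ as) b)
      ≡⟨ sym (ℕ.*-assoc k-1 _ _) ⟩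
    k-1 ^ suc n ℕ.* countSol W (a ∷ as) b ∎
    where
    open ≡-Reasoning
    k-1 : ℕ
    k-1 = pred (length W)
    F : ℚ → ℕ
    F x = sumOver (λ ps → pairCount ps as (b - ℤtoℚ a * x)) (powVec (pairs W) n)

  sumOver-powVec-≤ : ∀ {A : Set} {P : A → Set} {L} → All P L → ∀ n (f : Vec A n → ℕ) {U} →
    (∀ {v} → AllVec P v → f v ≤ U) → sumOver f (powVec L n) ≤ length L ^ n ℕ.* U
  sumOver-powVec-≤ PL zero f {U} f≤U = begin
    f [] ℕ.+ 0  ≡⟨ ℕ.+-identityʳ (f []) ⟩
    f []        ≤⟨ f≤U VecAll.[] ⟩
    U           ≡⟨ sym (ℕ.*-identityˡ U) ⟩
    1 ℕ.* U     ∎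
    where open ℕ.≤-Reasoning
  sumOver-powVec-≤ {L = L} PL (suc n) f {U} f≤U = begin
    sumOver f (powVec L (suc n))                        ≡⟨ sumOver-powVec-∷ L n f ⟩
    sumOver (λ x → sumOver (f ∘ (x ∷_)) (powVec L n)) L ≤⟨ sumOver-mono-All (λ Px → sumOver-powVec-≤ PL n _ (λ Pv → f≤U (Px VecAll.∷ Pv))) PL ⟩
    sumOver (λ _ → length L ^ n ℕ.* U) L                ≡⟨ sumOver-const _ L ⟩
    length L ℕ.* (length L ^ n ℕ.* U)                   ≡⟨ sym (ℕ.*-assoc (length L) _ U) ⟩
    length L ^ suc n ℕ.* U                              ∎
    where open ℕ.≤-Reasoning

  steps : ∀ {n} → Vec (ℚ × ℚ) n → Vec ℤ n → List ℚ
  steps [] [] = []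
  steps ((x , y) ∷ ps) (a ∷ as) = ℤtoℚ a * (y - x) ∷ steps ps as

  offset : ∀ {n} → Vec (ℚ × ℚ) n → Vec ℤ n → ℚ
  offset [] [] = 0ℚ
  offset ((x , y) ∷ ps) (a ∷ as) = ℤtoℚ a * x + offset ps as

  pairCount≡subsetSumCount : ∀ {n} (ps : Vec (ℚ × ℚ) n) as b → pairCount ps as b ≡ subsetSumCount (steps ps as) (b - offset ps as)
  pairCount≡subsetSumCount [] [] b =
    trans (cong (λ b′ → if does (0ℚ ℚ.≟ b′) then 1 else 0) (sym (ℚ.+-identityʳ b))) (sym (ℕ.+-identityʳ _))
  pairCount≡subsetSumCount ((x , y) ∷ ps) (a ∷ as) b = begin
    pairCount ps as (b - ℤtoℚ a * x) ℕ.+ pairCount ps as (b - ℤtoℚ a * y)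
      ≡⟨ cong₂ ℕ._+_ (pairCount≡subsetSumCount ps as _) (pairCount≡subsetSumCount ps as _) ⟩
    subsetSumCount ds (b - ℤtoℚ a * x - o) ℕ.+ subsetSumCount ds (b - ℤtoℚ a * y - o)
      ≡⟨ cong₂ (λ c c′ → subsetSumCount ds c ℕ.+ subsetSumCount ds c′) (base b (ℤtoℚ a) x o) (stepped b (ℤtoℚ a) x y o) ⟩
    subsetSumCount ds (b - (ℤtoℚ a * x + o)) ℕ.+ subsetSumCount ds (b - (ℤtoℚ a * x + o) - ℤtoℚ a * (y - x))
      ≡⟨ sym (subsetSumCount-cons (ℤtoℚ a * (y - x)) ds _) ⟩
    subsetSumCount (ℤtoℚ a * (y - x) ∷ ds) (b - (ℤtoℚ a * x + o)) ∎
    where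
    open ≡-Reasoning
    ds : List ℚ
    ds = steps ps as
    o : ℚ
    o = offset ps as
    base : ∀ b a x o → b - a * x - o ≡ b - (a * x + o)
    base = solve 4 (λ b a x o → b :- a :* x :- o := b :- (a :* x :+ o)) refl
    stepped : ∀ b a x y o → b - a * y - o ≡ b - (a * x + o) - a * (y - x)
    stepped = solve 5 (λ b a x y o → b :- a :* y :- o := b :- (a :* x :+ o) :- a :* (y :- x)) refl

  zeroEntries : ∀ {n} → Vec ℤ n → ℕ
  zeroEntries a = length (filter (ℤ._≟ + 0) (toList a))

  zeroEntries+weight : ∀ {n} (a : Vec ℤ n) → zeroEntries a ℕ.+ weight a ≡ n
  zeroEntries+weight [] = refl
  zeroEntries+weight (a ∷ as) with a ℤ.≟ + 0
  ... | yes _ = cong suc (zeroEntries+weight as)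
  ... | no _ = trans (ℕ.+-suc (zeroEntries as) (weight as)) (cong suc (zeroEntries+weight as))

  ℤtoℚ≡0⇒≡0 : ∀ a → ℤtoℚ a ≡ 0ℚ → a ≡ + 0
  ℤtoℚ≡0⇒≡0 a a≡0 = trans (sym (ℚ.↥-/ a 1)) (cong (λ q → ↥ q ℤ.* ℤgcd a (+ 1)) a≡0)

  p*r≡0⇒p≡0 : ∀ p r → p * r ≡ 0ℚ → r ≢ 0ℚ → p ≡ 0ℚ
  p*r≡0⇒p≡0 p r pr≡0 r≢0 = begin
    p                ≡⟨ sym (ℚ.*-identityʳ p) ⟩
    p * 1ℚ           ≡⟨ cong (p *_) (sym (ℚ.*-inverseʳ r)) ⟩
    p * (r * 1/ r)   ≡⟨ sym (ℚ.*-assoc p r (1/ r)) ⟩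
    p * r * 1/ r     ≡⟨ cong (_* 1/ r) pr≡0 ⟩
    0ℚ * 1/ r        ≡⟨ ℚ.*-zeroˡ (1/ r) ⟩
    0ℚ               ∎
    where
    open ≡-Reasoning
    instance _ = ≢-nonZero r≢0

  step-nonzero : ∀ {a x y} → a ≢ + 0 → x ≢ y → ℤtoℚ a * (y - x) ≢ 0ℚ
  step-nonzero {a} {x} {y} a≢0 x≢y step≡0 =
    a≢0 (ℤtoℚ≡0⇒≡0 a (p*r≡0⇒p≡0 (ℤtoℚ a) (y - x) step≡0 (x≢y ∘ sym ∘ y-x≡0⇒y≡x)))
    where
    y-x≡0⇒y≡x : y - x ≡ 0ℚ → y ≡ x
    y-x≡0⇒y≡x y-x≡0 = trans (expand y x) (trans (cong (_+ x) y-x≡0) (ℚ.+-identityˡ x))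
      where
      expand : ∀ y x → y ≡ y - x + x
      expand = solve 2 (λ y x → y := y :- x :+ x) refl

  steps-zeros : ∀ {n} (ps : Vec (ℚ × ℚ) n) as → AllVec (uncurry _≢_) ps →
    zeroCount (steps ps as) ≡ zeroEntries as × length (nonzeroMagnitudes (steps ps as)) ≡ weight as
  steps-zeros [] [] VecAll.[] = refl , refl
  steps-zeros ((x , y) ∷ ps) (a ∷ as) (x≢y VecAll.∷ distinct) with ℚ.<-cmp (ℤtoℚ a * (y - x)) 0ℚ | a ℤ.≟ + 0
  ... | tri< step<0 _ _ | yes refl = contradiction (ℚ.*-zeroˡ (y - x)) (ℚ.<⇒≢ step<0)
  ... | tri≈ _ step≡0 _ | no a≢0   = contradiction step≡0 (step-nonzero a≢0 x≢y)
  ... | tri> _ _ step>0 | yes refl = contradiction (sym (ℚ.*-zeroˡ (y - x))) (ℚ.<⇒≢ step>0)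
  ... | tri≈ _ _ _      | yes _    = let z , w = steps-zeros ps as distinct in cong suc z , w
  ... | tri< _ _ _      | no _     = let z , w = steps-zeros ps as distinct in z , cong suc w
  ... | tri> _ _ _      | no _     = let z , w = steps-zeros ps as distinct in z , cong suc w

  pairCount-bound : ∀ {n} (ps : Vec (ℚ × ℚ) n) as b → AllVec (uncurry _≢_) ps →
    pairCount ps as b ≤ 2 ^ zeroEntries as ℕ.* (weight as C ⌊ weight as /2⌋)
  pairCount-bound ps as b distinct = begin
    pairCount ps as b                                ≡⟨ pairCount≡subsetSumCount ps as b ⟩
    subsetSumCount (steps ps as) (b - offset ps as)  ≤⟨ subsetSumCount-bound (steps ps as) (b - offset ps as) ⟩
    2 ^ zeroCount (steps ps as) ℕ.* (m C ⌊ m /2⌋)     ≡⟨ cong₂ (λ z w → 2 ^ z ℕ.* (w C ⌊ w /2⌋)) z≡ w≡ ⟩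
    2 ^ zeroEntries as ℕ.* (weight as C ⌊ weight as /2⌋) ∎
    where
    open ℕ.≤-Reasoning
    m : ℕ
    m = length (nonzeroMagnitudes (steps ps as))
    z≡ : zeroCount (steps ps as) ≡ zeroEntries as
    z≡ = proj₁ (steps-zeros ps as distinct)
    w≡ : length (nonzeroMagnitudes (steps ps as)) ≡ weight as
    w≡ = proj₂ (steps-zeros ps as distinct)

  ^-distribʳ-* : ∀ m n o → (m ℕ.* n) ^ o ≡ m ^ o ℕ.* n ^ o
  ^-distribʳ-* m n zero = refl
  ^-distribʳ-* m n (suc o) = trans (cong (m ℕ.* n ℕ.*_) (^-distribʳ-* m n o)) (ℕ.[m*n]*[o*p]≡[m*o]*[n*p] m n (m ^ o) (n ^ o))

  cancel-pair-count : ∀ m L n c U → 2 ℕ.* L ≡ suc (suc m) ℕ.* suc m →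
    suc m ^ n ℕ.* c ≤ L ^ n ℕ.* U → 2 ^ n ℕ.* c ≤ suc (suc m) ^ n ℕ.* U
  cancel-pair-count m L n c U 2L≡k[k-1] averaged = ℕ.*-cancelˡ-≤ (suc m ^ n) {{ℕ.m^n≢0 (suc m) n}} (begin
    suc m ^ n ℕ.* (2 ^ n ℕ.* c)            ≡⟨ x∙yz≈y∙xz (suc m ^ n) (2 ^ n) c ⟩
    2 ^ n ℕ.* (suc m ^ n ℕ.* c)            ≤⟨ ℕ.*-monoʳ-≤ (2 ^ n) averaged ⟩
    2 ^ n ℕ.* (L ^ n ℕ.* U)                ≡⟨ sym (ℕ.*-assoc (2 ^ n) (L ^ n) U) ⟩
    2 ^ n ℕ.* L ^ n ℕ.* U                  ≡⟨ cong (ℕ._* U) (trans (sym (^-distribʳ-* 2 L n)) (cong (_^ n) 2L≡k[k-1])) ⟩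
    (suc (suc m) ℕ.* suc m) ^ n ℕ.* U      ≡⟨ cong (ℕ._* U) (trans (^-distribʳ-* (suc (suc m)) (suc m) n) (ℕ.*-comm (suc (suc m) ^ n) (suc m ^ n))) ⟩
    suc m ^ n ℕ.* suc (suc m) ^ n ℕ.* U    ≡⟨ ℕ.*-assoc (suc m ^ n) _ U ⟩
    suc m ^ n ℕ.* (suc (suc m) ^ n ℕ.* U)  ∎)
    where open ℕ.≤-Reasoning

  cancel-zero-entries : ∀ z w c K B → 2 ^ (z ℕ.+ w) ℕ.* c ≤ K ℕ.* (2 ^ z ℕ.* B) → 2 ^ w ℕ.* c ≤ K ℕ.* B
  cancel-zero-entries z w c K B bound = ℕ.*-cancelˡ-≤ (2 ^ z) {{ℕ.m^n≢0 2 z}} (begin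
    2 ^ z ℕ.* (2 ^ w ℕ.* c)  ≡⟨ sym (ℕ.*-assoc (2 ^ z) (2 ^ w) c) ⟩
    2 ^ z ℕ.* 2 ^ w ℕ.* c    ≡⟨ cong (ℕ._* c) (sym (ℕ.^-distribˡ-+-* 2 z w)) ⟩
    2 ^ (z ℕ.+ w) ℕ.* c      ≤⟨ bound ⟩
    K ℕ.* (2 ^ z ℕ.* B)      ≡⟨ x∙yz≈y∙xz K (2 ^ z) B ⟩
    2 ^ z ℕ.* (K ℕ.* B)      ∎)
    where open ℕ.≤-Reasoning

  square-bound : ∀ w c K B → 2 ^ w ℕ.* c ≤ K ℕ.* B → B ℕ.* B ℕ.* w ≤ 4 ^ w → c ℕ.* c ℕ.* w ≤ K ℕ.* K
  square-bound w c K B 2^wc≤KB B²w≤4^w = ℕ.*-cancelˡ-≤ (4 ^ w) {{ℕ.m^n≢0 4 w}} (begin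
    4 ^ w ℕ.* (c ℕ.* c ℕ.* w)                    ≡⟨ cong (ℕ._* (c ℕ.* c ℕ.* w)) (^-distribʳ-* 2 2 w) ⟩
    2 ^ w ℕ.* 2 ^ w ℕ.* (c ℕ.* c ℕ.* w)          ≡⟨ square (2 ^ w) c w ⟩
    (2 ^ w ℕ.* c) ℕ.* (2 ^ w ℕ.* c) ℕ.* w        ≤⟨ ℕ.*-monoˡ-≤ w (ℕ.*-mono-≤ 2^wc≤KB 2^wc≤KB) ⟩
    (K ℕ.* B) ℕ.* (K ℕ.* B) ℕ.* w                ≡⟨ unsquare K B w ⟩
    K ℕ.* K ℕ.* (B ℕ.* B ℕ.* w)                  ≤⟨ ℕ.*-monoʳ-≤ (K ℕ.* K) B²w≤4^w ⟩
    K ℕ.* K ℕ.* 4 ^ w                            ≡⟨ ℕ.*-comm (K ℕ.* K) (4 ^ w) ⟩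
    4 ^ w ℕ.* (K ℕ.* K)                          ∎)
    where
    open ℕ.≤-Reasoning
    square : ∀ p c w → p ℕ.* p ℕ.* (c ℕ.* c ℕ.* w) ≡ p ℕ.* c ℕ.* (p ℕ.* c) ℕ.* w
    square = solve-∀
    unsquare : ∀ K B w → K ℕ.* B ℕ.* (K ℕ.* B) ℕ.* w ≡ K ℕ.* K ℕ.* (B ℕ.* B ℕ.* w)
    unsquare = solve-∀

open MiddleBinomial using (middleBinomial-bound)
open PairAveraging

open import Defs
open import Data.Nat using (ℕ; _≤_; _^_; _*_; _+_; s≤s; pred; ⌊_/2⌋)
open import Data.Nat.Combinatorics using (_C_)
open import Data.Integer using (ℤ; +_)
open import Data.Rational using (ℚ; 0ℚ; 1ℚ)
open import Data.Product using (_×_)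
open import Data.List using (List; length; []; _∷_)
open import Data.List.Relation.Unary.All using (All)
open import Data.List.Relation.Unary.Unique.Propositional using (Unique)
open import Data.List.Membership.Propositional using (_∈_)
open import Data.Vec using (Vec; replicate)
open import Relation.Binary.PropositionalEquality using (_≢_; sym; subst)

mainTheorem10 : (W : List ℚ) → Unique W → All (λ x → (0ℚ Data.Rational.≤ x) × (x Data.Rational.≤ 1ℚ)) W → 0ℚ ∈ W → 2 ≤ length W →
  (n : ℕ) (a : Vec ℤ n) → a ≢ replicate n (+ 0) → (b : ℚ) →
  countSol W a b * countSol W a b * weight a ≤ length W ^ n * length W ^ n
mainTheorem10 W@(_ ∷ _ ∷ ys) W! _ _ _ n a _ b = square-bound w c K B 2ʷc≤KB (middleBinomial-bound w)
  where
  c : ℕ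
  c = countSol W a b
  w : ℕ
  w = weight a
  z : ℕ
  z = zeroEntries a
  K : ℕ
  K = length W ^ n
  B : ℕ
  B = w C ⌊ w /2⌋
  averaged : pred (length W) ^ n * c ≤ length (pairs W) ^ n * (2 ^ z * B)
  averaged = subst (_≤ _) (sumOver-pairCount W a b)
    (sumOver-powVec-≤ (pairs-distinct W!) n _ (pairCount-bound _ a b))
  2ⁿc≤K2ᶻB : 2 ^ (z + w) * c ≤ K * (2 ^ z * B)
  2ⁿc≤K2ᶻB = subst (λ m → 2 ^ m * c ≤ K * (2 ^ z * B)) (sym (zeroEntries+weight a))
    (cancel-pair-count (length ys) (length (pairs W)) n c _ (2*length-pairs W) averaged)
  2ʷc≤KB : 2 ^ w * c ≤ K * B
  2ʷc≤KB = cancel-zero-entries z w c K B 2ⁿc≤K2ᶻB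
mainTheorem10 (_ ∷ []) _ _ _ (s≤s ())
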